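{- Let $V_n$ be the approximating graphs of the Diamond fractal (defined in the context). For $n\ge1$, $V_n$ has $\frac{4+2\cdot4^n}{3}$ vertices, and its vertex set is the disjoint union of: (i) for each $1\le k\le n-1$, a set of $2\cdot4^{n-k}$ vertices each of degree $2^k$; (ii) a set of $4$ vertices each of degree $2^n$.
   Context: $V_0$ is a single edge joining two vertices $x_1,x_2$. For $n\ge1$, $V_n$ is obtained from $V_{n-1}$ by replacing each edge $\{u,v\}$ by a "diamond": two new vertices $a,b$ (distinct for different edges) and the four edges $ua,av,vb,bu$, the edge $\{u,v\}$ itself being removed. Thus $V_1$ is a 4-cycle. -}

module Defs where

open import Data.Nat using (ℕ; zero; suc; _+_; _*_; _≟_)
open import Data.Fin using (Fin)
open import Data.Product using (_×_; _,_; proj₁; proj₂)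
open import Data.List using (List; []; _∷_; length; filter; allFin)
open import Data.Sum using (_⊎_)
open import Relation.Binary.PropositionalEquality using (_≡_)
open import Relation.Nullary.Decidable using (_⊎-dec_)

-- A finite graph with vertex set {0,…,nv-1}, given by its list of edges
-- (each unordered edge {u,v} listed once as a pair (u , v)).
record Graph : Set where
  constructor graph
  field
    nv    : ℕ
    edges : List (ℕ × ℕ)
open Graph public

-- Replace each edge (u , v) of the list by a diamond, using fresh vertices
-- a = m, b = m + 1 (m is the next unused label), edges ua, av, vb, bu.
diamondStep : ℕ → List (ℕ × ℕ) → List (ℕ × ℕ)
diamondStep m [] = []
diamondStep m ((u , v) ∷ es) =
  (u , m) ∷ (m , v) ∷ (v , suc m) ∷ (suc m , u) ∷ diamondStep (suc (suc m)) es

-- The approximating graphs V_n of the Diamond fractal.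
-- V_0: vertices x₁ = 0, x₂ = 1 and the single edge {0,1}.
V : ℕ → Graph
V zero = graph 2 ((0 , 1) ∷ [])
V (suc n) = graph (nv (V n) + 2 * length (edges (V n)))
                  (diamondStep (nv (V n)) (edges (V n)))

degree : Graph → ℕ → ℕ
degree G x = length (filter (λ e → (x ≟ proj₁ e) ⊎-dec (x ≟ proj₂ e)) (edges G))

classSize : {N : ℕ} → (Fin N → ℕ) → ℕ → ℕ
classSize {N} c k = length (filter (λ v → c v ≟ k) (allFin N))

module Submission where

-- Write N n = nv (V n) and E n = edges (V n).
-- Degrees are read off the multiset of edge endpoints: in a loop-free edge
-- list the degree of x is the multiplicity of x among the endpoints.  One
-- diamond step with fresh labels m, m+1, … lists every old endpoint twice and
-- every fresh vertex twice, so
--     mult x (ends (diamondStep m es)) = 2 · (mult x (ends es) + mult x (fresh m es)).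
-- Hence an old vertex doubles its degree and a new vertex gets degree 2.
-- Define the level of a vertex of V n: old vertices of V (n+1) go up one level,
-- new ones have level 1; then every vertex of V n has degree 2 ^ level.
-- The list of levels ("profile") of V (n+1) is that of V n shifted by one
-- followed by 2 · 4 ^ n ones, since V n has 4 ^ n edges.  Counting
-- occurrences of a level k through this recursion gives the class sizes
-- 2 · 4 ^ (n - k) for 1 ≤ k < n and 4 for k = n; the vertex count
-- N n = (4 + 2 · 4 ^ n) / 3 follows from N (n+1) = N n + 2 · 4 ^ n.

open import Defs
open import Data.Nat using (ℕ; zero; suc; _+_; _*_; _∸_; _^_; _≤_; _<_; _/_; _≟_; _<?_; z≤n; s≤s; z<s)
open import Data.Nat.Properties
open import Data.Nat.DivMod using (m*n/n≡m)
open import Data.Nat.Tactic.RingSolver using (solve-∀)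
open import Data.Fin using (Fin; toℕ)
open import Data.Fin.Properties using (toℕ<n)
open import Data.Product using (Σ; _×_; _,_; proj₁; proj₂)
open import Data.Sum using (_⊎_)
open import Data.List using (List; []; _∷_; _++_; length; filter; map; replicate; applyUpTo; tabulate; allFin)
open import Data.List.Properties using (map-tabulate; map-applyUpTo; filter-accept; filter-reject)
open import Data.List.Relation.Unary.All as All using (All; []; _∷_)
open import Data.List.Relation.Unary.All.Properties using (applyUpTo⁺₂)
open import Data.Bool using (true; false)
open import Data.Empty using (⊥-elim)
open import Function using (_∘_)
open import Relation.Nullary using (Dec; yes; no; _because_)
open import Relation.Nullary.Decidable using (_⊎-dec_)
open import Relation.Binary.PropositionalEquality
  using (_≡_; _≢_; refl; sym; trans; cong; cong₂; subst; module ≡-Reasoning)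
open ≡-Reasoning

indicator : {P : Set} → Dec P → ℕ
indicator (true  because _) = 1
indicator (false because _) = 0

indicator-≡ : {a b : ℕ} → a ≡ b → indicator (a ≟ b) ≡ 1
indicator-≡ {a} {b} a≡b with a ≟ b
... | yes _  = refl
... | no a≢b = ⊥-elim (a≢b a≡b)

indicator-≢ : {a b : ℕ} → a ≢ b → indicator (a ≟ b) ≡ 0
indicator-≢ {a} {b} a≢b with a ≟ b
... | yes a≡b = ⊥-elim (a≢b a≡b)
... | no _    = refl

indicator-suc : (a b : ℕ) → indicator (suc a ≟ suc b) ≡ indicator (a ≟ b)
indicator-suc a b with a ≟ b
... | yes a≡b = indicator-≡ (cong suc a≡b)
... | no a≢b  = indicator-≢ (a≢b ∘ suc-injective)

mult : ℕ → List ℕ → ℕ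
mult k []       = 0
mult k (y ∷ ys) = indicator (y ≟ k) + mult k ys

mult-++ : (k : ℕ) (xs ys : List ℕ) → mult k (xs ++ ys) ≡ mult k xs + mult k ys
mult-++ k []       ys = refl
mult-++ k (x ∷ xs) ys =
  trans (cong (indicator (x ≟ k) +_) (mult-++ k xs ys)) (sym (+-assoc (indicator (x ≟ k)) _ _))

mult-replicate : (k j M : ℕ) → mult k (replicate M j) ≡ indicator (j ≟ k) * M
mult-replicate k j zero    = sym (*-zeroʳ (indicator (j ≟ k)))
mult-replicate k j (suc M) =
  trans (cong (indicator (j ≟ k) +_) (mult-replicate k j M)) (sym (*-suc (indicator (j ≟ k)) M))

mult-map-suc : (k : ℕ) (ys : List ℕ) → mult (suc k) (map suc ys) ≡ mult k ys
mult-map-suc k []       = refl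
mult-map-suc k (y ∷ ys) = cong₂ _+_ (indicator-suc y k) (mult-map-suc k ys)

mult-absent : (k : ℕ) {ys : List ℕ} → All (_≢ k) ys → mult k ys ≡ 0
mult-absent k []         = refl
mult-absent k (y≢k ∷ ps) = cong₂ _+_ (indicator-≢ y≢k) (mult-absent k ps)

length-filter-mult : {A : Set} (c : A → ℕ) (k : ℕ) (xs : List A) →
  length (filter (λ v → c v ≟ k) xs) ≡ mult k (map c xs)
length-filter-mult c k []       = refl
length-filter-mult c k (x ∷ xs) with c x ≟ k
... | yes cx≡k = trans (cong length (filter-accept (λ v → c v ≟ k) cx≡k))
                       (cong suc (length-filter-mult c k xs))
... | no cx≢k  = trans (cong length (filter-reject (λ v → c v ≟ k) cx≢k))
                       (length-filter-mult c k xs)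

ends : List (ℕ × ℕ) → List ℕ
ends []              = []
ends ((u , v) ∷ es) = u ∷ v ∷ ends es

fresh : ℕ → List (ℕ × ℕ) → List ℕ
fresh m []       = []
fresh m (_ ∷ es) = m ∷ suc m ∷ fresh (suc (suc m)) es

mult-ends-diamondStep : (m : ℕ) (es : List (ℕ × ℕ)) (x : ℕ) →
  mult x (ends (diamondStep m es)) ≡ 2 * (mult x (ends es) + mult x (fresh m es))
mult-ends-diamondStep m []              x = refl
mult-ends-diamondStep m ((u , v) ∷ es) x =
  begin
    [u] + ([m] + ([m] + ([v] + ([v] + ([m'] + ([m'] + ([u] + rest)))))))
  ≡⟨ cong (λ r → [u] + ([m] + ([m] + ([v] + ([v] + ([m'] + ([m'] + ([u] + r))))))))
          (mult-ends-diamondStep (suc (suc m)) es x) ⟩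
    [u] + ([m] + ([m] + ([v] + ([v] + ([m'] + ([m'] + ([u] + 2 * (old + new))))))))
  ≡⟨ regroup [u] [v] [m] [m'] old new ⟩
    2 * (([u] + ([v] + old)) + ([m] + ([m'] + new)))
  ∎
  where
  [u] [v] [m] [m'] rest old new : ℕ
  [u] = indicator (u ≟ x)
  [v] = indicator (v ≟ x)
  [m] = indicator (m ≟ x)
  [m'] = indicator (suc m ≟ x)
  rest = mult x (ends (diamondStep (suc (suc m)) es))
  old = mult x (ends es)
  new = mult x (fresh (suc (suc m)) es)
  regroup : ∀ a b c d p q →
    a + (c + (c + (b + (b + (d + (d + (a + 2 * (p + q)))))))) ≡ 2 * ((a + (b + p)) + (c + (d + q)))
  regroup = solve-∀

fresh-above : (m : ℕ) (es : List (ℕ × ℕ)) → All (m ≤_) (fresh m es)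
fresh-above m []       = []
fresh-above m (_ ∷ es) =
  ≤-refl ∷ n≤1+n m ∷ All.map (≤-trans (m≤n+m m 2)) (fresh-above (suc (suc m)) es)

mult-fresh-below : (m : ℕ) (es : List (ℕ × ℕ)) {x : ℕ} → x < m → mult x (fresh m es) ≡ 0
mult-fresh-below m es {x} x<m =
  mult-absent x (All.map (λ m≤y y≡x → <⇒≢ (<-≤-trans x<m m≤y) (sym y≡x)) (fresh-above m es))

-- The label bound after one more edge, as seen from the next fresh label.
two-more : (m L : ℕ) → m + 2 * suc L ≡ suc (suc m) + 2 * L
two-more = solve-∀

mult-fresh : (m : ℕ) (es : List (ℕ × ℕ)) (x : ℕ) →
  m ≤ x → x < m + 2 * length es → mult x (fresh m es) ≡ 1
mult-fresh m [] x m≤x x<m+0 =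
  ⊥-elim (<⇒≱ (subst (x <_) (+-identityʳ m) x<m+0) m≤x)
mult-fresh m (_ ∷ es) x m≤x x<bound with m ≟ x | suc m ≟ x
... | yes refl | yes m'≡m = ⊥-elim (1+n≢n m'≡m)
... | yes refl | no _     = cong suc (mult-fresh-below (suc (suc m)) es (m<n⇒m<1+n (n<1+n m)))
... | no _     | yes refl = cong suc (mult-fresh-below (suc (suc m)) es (n<1+n (suc m)))
... | no m≢x   | no m'≢x  =
  mult-fresh (suc (suc m)) es x (≤∧≢⇒< (≤∧≢⇒< m≤x m≢x) m'≢x)
    (subst (x <_) (two-more m (length es)) x<bound)

Bounded : ℕ → List (ℕ × ℕ) → Set
Bounded m es = All (_< m) (ends es)

LoopFree : List (ℕ × ℕ) → Set
LoopFree = All (λ e → proj₁ e ≢ proj₂ e)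

bounded-weaken : {m m' : ℕ} (es : List (ℕ × ℕ)) → m ≤ m' → Bounded m es → Bounded m' es
bounded-weaken es m≤m' = All.map (λ y<m → <-≤-trans y<m m≤m')

length-diamondStep : (m : ℕ) (es : List (ℕ × ℕ)) → length (diamondStep m es) ≡ 4 * length es
length-diamondStep m []       = refl
length-diamondStep m (_ ∷ es) =
  trans (cong (4 +_) (length-diamondStep (suc (suc m)) es)) (sym (*-suc 4 (length es)))

bounded-diamondStep : (m : ℕ) (es : List (ℕ × ℕ)) →
  Bounded m es → Bounded (m + 2 * length es) (diamondStep m es)
bounded-diamondStep m []              []                 = []
bounded-diamondStep m ((u , v) ∷ es) (u<m ∷ v<m ∷ rest) =
  subst (λ T → Bounded T (diamondStep m ((u , v) ∷ es))) (sym (two-more m L))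
    (old u<m ∷ m<T ∷ m<T ∷ old v<m ∷ old v<m ∷ m'<T ∷ m'<T ∷ old u<m ∷
     bounded-diamondStep (suc (suc m)) es (bounded-weaken es (m≤n+m m 2) rest))
  where
  L T : ℕ
  L = length es
  T = suc (suc m) + 2 * L
  m'<T : suc m < T
  m'<T = s≤s (s≤s (m≤m+n m (2 * L)))
  m<T : m < T
  m<T = <-trans (n<1+n m) m'<T
  old : {y : ℕ} → y < m → y < T
  old y<m = <-trans y<m m<T

-- The new edges join old vertices (below m) to fresh ones, so they are no loops.
loopFree-diamondStep : (m : ℕ) (es : List (ℕ × ℕ)) → Bounded m es → LoopFree (diamondStep m es)
loopFree-diamondStep m []              []                 = []
loopFree-diamondStep m ((u , v) ∷ es) (u<m ∷ v<m ∷ rest) =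
  <⇒≢ u<m ∷ (<⇒≢ v<m ∘ sym) ∷ <⇒≢ (m<n⇒m<1+n v<m) ∷ (<⇒≢ (m<n⇒m<1+n u<m) ∘ sym) ∷
  loopFree-diamondStep (suc (suc m)) es (bounded-weaken es (m≤n+m m 2) rest)

incidences : ℕ → List (ℕ × ℕ) → ℕ
incidences x es = length (filter (λ e → (x ≟ proj₁ e) ⊎-dec (x ≟ proj₂ e)) es)

incidence-split : (x u v : ℕ) → u ≢ v →
  indicator ((x ≟ u) ⊎-dec (x ≟ v)) ≡ indicator (u ≟ x) + indicator (v ≟ x)
incidence-split x u v u≢v with x ≟ u | x ≟ v
... | yes x≡u | yes x≡v = ⊥-elim (u≢v (trans (sym x≡u) x≡v))
... | yes x≡u | no x≢v  = sym (cong₂ _+_ (indicator-≡ (sym x≡u)) (indicator-≢ (x≢v ∘ sym)))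
... | no x≢u  | yes x≡v = sym (cong₂ _+_ (indicator-≢ (x≢u ∘ sym)) (indicator-≡ (sym x≡v)))
... | no x≢u  | no x≢v  = sym (cong₂ _+_ (indicator-≢ (x≢u ∘ sym)) (indicator-≢ (x≢v ∘ sym)))

incidences-ends : (x : ℕ) (es : List (ℕ × ℕ)) → LoopFree es → incidences x es ≡ mult x (ends es)
incidences-ends x []              []            = refl
incidences-ends x ((u , v) ∷ es) (u≢v ∷ rest) =
  begin
    length (filter P? ((u , v) ∷ es))
  ≡⟨ length-filter-∷ ⟩
    indicator ((x ≟ u) ⊎-dec (x ≟ v)) + incidences x es
  ≡⟨ cong₂ _+_ (incidence-split x u v u≢v) (incidences-ends x es rest) ⟩
    (indicator (u ≟ x) + indicator (v ≟ x)) + mult x (ends es)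
  ≡⟨ +-assoc (indicator (u ≟ x)) _ _ ⟩
    mult x (ends ((u , v) ∷ es))
  ∎
  where
  P? : (e : ℕ × ℕ) → Dec (x ≡ proj₁ e ⊎ x ≡ proj₂ e)
  P? e = (x ≟ proj₁ e) ⊎-dec (x ≟ proj₂ e)
  length-filter-∷ : length (filter P? ((u , v) ∷ es)) ≡ indicator (P? (u , v)) + incidences x es
  length-filter-∷ with P? (u , v)
  ... | yes p = cong length (filter-accept P? p)
  ... | no ¬p = cong length (filter-reject P? ¬p)

N : ℕ → ℕ
N n = nv (V n)

E : ℕ → List (ℕ × ℕ)
E n = edges (V n)

edge-count : (n : ℕ) → length (E n) ≡ 4 ^ n
edge-count zero    = refl
edge-count (suc n) = trans (length-diamondStep (N n) (E n)) (cong (4 *_) (edge-count n))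

-- 3 · N n = 4 + 2 · 4 ^ n, because the step from V n adds 2 · 4 ^ n vertices.
vertex-count : (n : ℕ) → N n * 3 ≡ 4 + 2 * 4 ^ n
vertex-count zero    = refl
vertex-count (suc n) =
  begin
    (N n + 2 * length (E n)) * 3
  ≡⟨ cong (λ L → (N n + 2 * L) * 3) (edge-count n) ⟩
    (N n + 2 * 4 ^ n) * 3
  ≡⟨ distribute (N n) (4 ^ n) ⟩
    N n * 3 + 6 * 4 ^ n
  ≡⟨ cong (_+ 6 * 4 ^ n) (vertex-count n) ⟩
    4 + 2 * 4 ^ n + 6 * 4 ^ n
  ≡⟨ collect (4 ^ n) ⟩
    4 + 2 * 4 ^ suc n
  ∎
  where
  distribute : ∀ a p → (a + 2 * p) * 3 ≡ a * 3 + 6 * p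
  distribute = solve-∀
  collect : ∀ p → 4 + 2 * p + 6 * p ≡ 4 + 2 * (4 * p)
  collect = solve-∀

bounded-V : (n : ℕ) → Bounded (N n) (E n)
bounded-V zero    = s≤s z≤n ∷ s≤s (s≤s z≤n) ∷ []
bounded-V (suc n) = bounded-diamondStep (N n) (E n) (bounded-V n)

loopFree-V : (n : ℕ) → LoopFree (E n)
loopFree-V zero    = (λ ()) ∷ []
loopFree-V (suc n) = loopFree-diamondStep (N n) (E n) (bounded-V n)

-- The level of a vertex of V n: vertices of V n keep their label in V (n+1)
-- and go up one level; the vertices created by the step have level 1.
level : ℕ → ℕ → ℕ
level zero    x = 0
level (suc n) x with x <? N n
... | yes _ = suc (level n x)
... | no  _ = 1

level-old : (n x : ℕ) → x < N n → level (suc n) x ≡ suc (level n x)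
level-old n x x<N with x <? N n
... | yes _   = refl
... | no  x≮N = ⊥-elim (x≮N x<N)

level-new : (n x : ℕ) → N n ≤ x → level (suc n) x ≡ 1
level-new n x N≤x with x <? N n
... | yes x<N = ⊥-elim (<⇒≱ x<N N≤x)
... | no  _   = refl

level-positive : (n x : ℕ) → 1 ≤ level (suc n) x
level-positive n x with x <? N n
... | yes _ = s≤s z≤n
... | no  _ = s≤s z≤n

level-≤ : (n x : ℕ) → level n x ≤ n
level-≤ zero    x = z≤n
level-≤ (suc n) x with x <? N n
... | yes _ = s≤s (level-≤ n x)
... | no  _ = s≤s z≤n

mult-ends-V : (n x : ℕ) → x < N n → mult x (ends (E n)) ≡ 2 ^ level n x
mult-ends-V zero    zero          _                 = refl
mult-ends-V zero    (suc zero)    _                 = refl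
mult-ends-V zero    (suc (suc x)) (s≤s (s≤s ()))
mult-ends-V (suc n) x x<N' with x <? N n
... | yes x<N =
  begin
    mult x (ends (E (suc n)))
  ≡⟨ mult-ends-diamondStep (N n) (E n) x ⟩
    2 * (mult x (ends (E n)) + mult x (fresh (N n) (E n)))
  ≡⟨ cong (λ f → 2 * (mult x (ends (E n)) + f)) (mult-fresh-below (N n) (E n) x<N) ⟩
    2 * (mult x (ends (E n)) + 0)
  ≡⟨ cong (2 *_) (trans (+-identityʳ _) (mult-ends-V n x x<N)) ⟩
    2 * 2 ^ level n x
  ∎
... | no x≮N =
  begin
    mult x (ends (E (suc n)))
  ≡⟨ mult-ends-diamondStep (N n) (E n) x ⟩
    2 * (mult x (ends (E n)) + mult x (fresh (N n) (E n)))
  ≡⟨ cong₂ (λ o f → 2 * (o + f)) not-old (mult-fresh (N n) (E n) x (≮⇒≥ x≮N) x<N') ⟩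
    2
  ∎
  where
  not-old : mult x (ends (E n)) ≡ 0
  not-old = mult-absent x (All.map (λ y<N y≡x → x≮N (subst (_< N n) y≡x y<N)) (bounded-V n))

degree-V : (n x : ℕ) → x < N n → degree (V n) x ≡ 2 ^ level n x
degree-V n x x<N = trans (incidences-ends x (E n) (loopFree-V n)) (mult-ends-V n x x<N)

applyUpTo-++ : {A : Set} (f : ℕ → A) (a b : ℕ) →
  applyUpTo f (a + b) ≡ applyUpTo f a ++ applyUpTo (f ∘ (a +_)) b
applyUpTo-++ f zero    b = refl
applyUpTo-++ f (suc a) b = cong (f 0 ∷_) (applyUpTo-++ (f ∘ suc) a b)

applyUpTo-cong : {A : Set} {f g : ℕ → A} (M : ℕ) → (∀ x → x < M → f x ≡ g x) →
  applyUpTo f M ≡ applyUpTo g M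
applyUpTo-cong zero    f≡g = refl
applyUpTo-cong (suc M) f≡g =
  cong₂ _∷_ (f≡g 0 z<s) (applyUpTo-cong M (λ x x<M → f≡g (suc x) (s≤s x<M)))

applyUpTo-const : {A : Set} (j : A) (M : ℕ) → applyUpTo (λ _ → j) M ≡ replicate M j
applyUpTo-const j zero    = refl
applyUpTo-const j (suc M) = cong (j ∷_) (applyUpTo-const j M)

tabulate-toℕ : {A : Set} (M : ℕ) (f : ℕ → A) → tabulate {n = M} (f ∘ toℕ) ≡ applyUpTo f M
tabulate-toℕ zero    f = refl
tabulate-toℕ (suc M) f = cong (f 0 ∷_) (tabulate-toℕ M (f ∘ suc))

profile : ℕ → List ℕ
profile n = applyUpTo (level n) (N n)

classSize-profile : (n k : ℕ) →
  classSize (λ (v : Fin (N n)) → level n (toℕ v)) k ≡ mult k (profile n)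
classSize-profile n k =
  trans (length-filter-mult (level n ∘ toℕ) k (allFin (N n)))
        (cong (mult k) (trans (map-tabulate (λ v → v) (level n ∘ toℕ)) (tabulate-toℕ (N n) (level n))))

profile-step : (n : ℕ) → profile (suc n) ≡ map suc (profile n) ++ replicate (2 * 4 ^ n) 1
profile-step n =
  begin
    applyUpTo (level (suc n)) (N n + 2 * length (E n))
  ≡⟨ applyUpTo-++ (level (suc n)) (N n) (2 * length (E n)) ⟩
    applyUpTo (level (suc n)) (N n) ++ applyUpTo (level (suc n) ∘ (N n +_)) (2 * length (E n))
  ≡⟨ cong₂ _++_ (applyUpTo-cong (N n) (level-old n))
                (applyUpTo-cong (2 * length (E n)) (λ x _ → level-new n (N n + x) (m≤m+n (N n) x))) ⟩
    applyUpTo (suc ∘ level n) (N n) ++ applyUpTo (λ _ → 1) (2 * length (E n))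
  ≡⟨ cong₂ _++_ (sym (map-applyUpTo (level n) suc (N n)))
                (trans (applyUpTo-const 1 _) (cong (λ L → replicate (2 * L) 1) (edge-count n))) ⟩
    map suc (profile n) ++ replicate (2 * 4 ^ n) 1
  ∎

class-step : (n k : ℕ) →
  mult (suc k) (profile (suc n)) ≡ mult k (profile n) + indicator (0 ≟ k) * (2 * 4 ^ n)
class-step n k =
  begin
    mult (suc k) (profile (suc n))
  ≡⟨ cong (mult (suc k)) (profile-step n) ⟩
    mult (suc k) (map suc (profile n) ++ replicate (2 * 4 ^ n) 1)
  ≡⟨ mult-++ (suc k) (map suc (profile n)) _ ⟩
    mult (suc k) (map suc (profile n)) + mult (suc k) (replicate (2 * 4 ^ n) 1)
  ≡⟨ cong₂ _+_ (mult-map-suc k (profile n))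
                (trans (mult-replicate (suc k) 1 _) (cong (_* (2 * 4 ^ n)) (indicator-suc 0 k))) ⟩
    mult k (profile n) + indicator (0 ≟ k) * (2 * 4 ^ n)
  ∎

no-level-zero : (n : ℕ) → mult 0 (profile (suc n)) ≡ 0
no-level-zero n =
  mult-absent 0 (applyUpTo⁺₂ (level (suc n)) (N (suc n)) (λ x → >⇒≢ (level-positive n x)))

class-interior : {k n : ℕ} → k < n → mult (suc k) (profile (suc n)) ≡ 2 * 4 ^ (n ∸ k)
class-interior {zero}  {suc n} _         =
  trans (class-step (suc n) 0) (cong₂ _+_ (no-level-zero n) (*-identityˡ (2 * 4 ^ suc n)))
class-interior {suc k} {suc n} (s≤s k<n) =
  trans (class-step (suc n) (suc k)) (trans (+-identityʳ _) (class-interior k<n))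

-- In V (n+1), the top level n+1 consists of the four vertices of V 1.
class-top : (n : ℕ) → mult (suc n) (profile (suc n)) ≡ 4
class-top zero    = refl
class-top (suc n) = trans (class-step (suc n) (suc n)) (trans (+-identityʳ _) (class-top n))

-- Colour every vertex by its level.
lemma5p8 : (n : ℕ) → 1 ≤ n →
    (nv (V n) ≡ (4 + 2 * 4 ^ n) / 3) ×
    Σ (Fin (nv (V n)) → ℕ) (λ c →
      ((v : Fin (nv (V n))) →
          1 ≤ c v × c v ≤ n × degree (V n) (toℕ v) ≡ 2 ^ c v) ×
      ((k : ℕ) → 1 ≤ k → k < n → classSize c k ≡ 2 * 4 ^ (n ∸ k)) ×
      classSize c n ≡ 4)
lemma5p8 (suc n) _ =
  trans (sym (m*n/n≡m (N (suc n)) 3)) (cong (_/ 3) (vertex-count (suc n))) ,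
  level (suc n) ∘ toℕ ,
  (λ v → level-positive n (toℕ v) , level-≤ (suc n) (toℕ v) , degree-V (suc n) (toℕ v) (toℕ<n v)) ,
  (λ { (suc k) _ (s≤s k<n) → trans (classSize-profile (suc n) (suc k)) (class-interior k<n) }) ,
  trans (classSize-profile (suc n) (suc n)) (class-top n)
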